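{- For all non-negative integers $n$ and $t$, the integer $t\cdot\binom{2n+t}{t}$ is divisible by $2n+1$. -}

module Defs where

{-# OPTIONS --safe #-}
module Submission where

open import Defs
open import Data.Nat using (ℕ; zero; suc; _+_; _*_)
open import Data.Nat.Divisibility using (_∣_; divides)
open import Data.Nat.Combinatorics using (_C_; nC1≡n; nCk+nC[k+1]≡[n+1]C[k+1])
open import Data.Nat.Properties
  using (+-comm; *-comm; *-zeroʳ; *-identityˡ; *-identityʳ; +-identityʳ; +-cancelʳ-≡)
open import Data.Nat.Tactic.RingSolver using (solve-∀)
open import Relation.Binary.PropositionalEquality
  using (_≡_; refl; sym; cong; cong₂; module ≡-Reasoning)

-- For t = s + 1 and m = 2n + t, the absorption identity
-- (s + 1)·C(m, s + 1) = (m − s)·C(m, s) reads t·C(m, t) = (2n + 1)·C(m, t − 1).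

-- Absorption (k + 1)·C(n, k + 1) = (n − k)·C(n, k), with k·C(n, k) moved across
-- so that no truncated subtraction occurs.
[k+1]*nC[k+1]+k*nCk≡n*nCk : ∀ n k → suc k * (n C suc k) + k * (n C k) ≡ n * (n C k)
[k+1]*nC[k+1]+k*nCk≡n*nCk zero    zero    = refl
[k+1]*nC[k+1]+k*nCk≡n*nCk zero    (suc k) = cong₂ _+_ (*-zeroʳ (suc (suc k))) (*-zeroʳ (suc k))
[k+1]*nC[k+1]+k*nCk≡n*nCk (suc n) zero    = begin
  1 * (suc n C 1) + 0  ≡⟨ +-identityʳ _ ⟩
  1 * (suc n C 1)      ≡⟨ *-identityˡ _ ⟩
  suc n C 1            ≡⟨ nC1≡n (suc n) ⟩
  suc n                ≡⟨ sym (*-identityʳ (suc n)) ⟩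
  suc n * 1            ∎
  where open ≡-Reasoning
[k+1]*nC[k+1]+k*nCk≡n*nCk (suc n) (suc k) = begin
  suc (suc k) * (suc n C suc (suc k)) + suc k * (suc n C suc k)
    ≡⟨ cong₂ (λ a b → suc (suc k) * a + suc k * b) (sym (pascal (suc k))) (sym (pascal k)) ⟩
  suc (suc k) * (Y + Z) + suc k * (X + Y)
    ≡⟨ regroup k X Y Z ⟩
  (Y + X) + (suc (suc k) * Z + suc k * Y) + (suc k * Y + k * X)
    ≡⟨ cong₂ (λ a b → (Y + X) + a + b) (ih (suc k)) (ih k) ⟩
  (Y + X) + n * Y + n * X
    ≡⟨ factor n X Y ⟩
  suc n * (X + Y)
    ≡⟨ cong (suc n *_) (pascal k) ⟩
  suc n * (suc n C suc k) ∎
  where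
  open ≡-Reasoning
  pascal = nCk+nC[k+1]≡[n+1]C[k+1] n
  ih = [k+1]*nC[k+1]+k*nCk≡n*nCk n
  X = n C k
  Y = n C suc k
  Z = n C suc (suc k)
  regroup : ∀ j x y z → suc (suc j) * (y + z) + suc j * (x + y)
                      ≡ (y + x) + (suc (suc j) * z + suc j * y) + (suc j * y + j * x)
  regroup = solve-∀
  factor : ∀ a x y → (y + x) + a * y + a * x ≡ suc a * (x + y)
  factor = solve-∀

[k+1]*[m+k+1]C[k+1]≡[m+1]*[m+k+1]Ck : ∀ m k → suc k * ((m + suc k) C suc k) ≡ suc m * ((m + suc k) C k)
[k+1]*[m+k+1]C[k+1]≡[m+1]*[m+k+1]Ck m k = +-cancelʳ-≡ (k * X) _ _ (begin
  suc k * ((m + suc k) C suc k) + k * X  ≡⟨ [k+1]*nC[k+1]+k*nCk≡n*nCk (m + suc k) k ⟩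
  (m + suc k) * X                        ≡⟨ split m k X ⟩
  suc m * X + k * X                      ∎)
  where
  open ≡-Reasoning
  X = (m + suc k) C k
  split : ∀ a b x → (a + suc b) * x ≡ suc a * x + b * x
  split = solve-∀

proposition3 : (n t : ℕ) → (2 * n + 1) ∣ (t * ((2 * n + t) C t))
proposition3 n zero    = divides 0 refl
proposition3 n (suc s) = divides (m C s) (begin
  suc s * (m C suc s)    ≡⟨ [k+1]*[m+k+1]C[k+1]≡[m+1]*[m+k+1]Ck (2 * n) s ⟩
  suc (2 * n) * (m C s)  ≡⟨ *-comm (suc (2 * n)) (m C s) ⟩
  (m C s) * suc (2 * n)  ≡⟨ cong ((m C s) *_) (+-comm 1 (2 * n)) ⟩
  (m C s) * (2 * n + 1)  ∎)
  where
  open ≡-Reasoning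
  m = 2 * n + suc s
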